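{- Let $p$ be a prime and let $(\Omega,S)$ be a coherent configuration with fibers $\Omega_1,\dots,\Omega_m$ such that $(\Omega_i,S_i)\simeq C_p\wr C_p$ for each $i$ and $n_s=p$ for each $s\in\bigcup_{i\ne j}S_{ij}$. Let $R$ be the set of regular elements of $S$ and $N:=\bigcup_{i=1}^mS_i\cup(S\setminus R)$. Then $\bigcup_{s\in N}s$ is an equivalence relation on $\Omega$.
   Context: A coherent configuration is a pair $(\Omega,S)$ of a finite set $\Omega$ and a partition $S$ of $\Omega\times\Omega$ such that $1_\Omega$ is a union of elements of $S$, $s^\ast:=\{(\beta,\alpha)\mid(\alpha,\beta)\in s\}\in S$ for $s\in S$, and $\sigma_s\sigma_t=\sum_{u\in S}c_{st}^u\sigma_u$ with nonnegative integers $c_{st}^u$, where $\sigma_u$ is the adjacency matrix of $u$. Fibers are the sets $\Delta$ with $1_\Delta\in S$; they partition $\Omega$. $S_{ij}:=\{s\in S\mid s\subseteq\Omega_i\times\Omega_j\}$, $S_i:=S_{ii}$. For $s\in S_{ij}$, $n_s:=|\{\beta\mid(\alpha,\beta)\in s\}|$ for any $\alpha\in\Omega_i$. The complex product of $T,U\subseteq S$ is $TU:=\{s\mid c_{tu}^s>0$ for some $t\in T,u\in U\}$, singletons written without braces. An element $s\in S$ is regular if $ss^\ast s=\{s\}$. $C_p\wr C_p$ is the association scheme on $\mathbb{Z}_p\times\mathbb{Z}_p$ with relations $\{((x,y),(x+a,y))\}$ ($a\in\mathbb{Z}_p$) and $\{((x_1,y),(x_2,y+b))\}$ ($b\ne0$).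 -}

module Defs where

open import Data.Nat using (ℕ; zero; suc; _+_; _∸_; _≤ᵇ_)
open import Data.Bool using (Bool; true; false; if_then_else_; _∧_)
open import Data.Fin using (Fin; toℕ) renaming (zero to fz; suc to fs)
open import Data.Fin.Properties using (_≟_)
open import Data.Product using (Σ; ∃; ∃-syntax; _×_; _,_)
open import Data.Sum using (_⊎_; inj₁; inj₂)
open import Relation.Nullary using (¬_; Dec; yes; no; does)
open import Relation.Binary.PropositionalEquality using (_≡_)
open import Function.Bundles using (_⇔_)

count : ∀ {n} → (Fin n → Bool) → ℕ
count {zero} P = 0
count {suc n} P = (if P fz then 1 else 0) + count (λ γ → P (fs γ))

-- A coherent configuration on Ω = Fin n whose set of basis relations S is
-- indexed by Fin r: col α β is the (index of the) basis relation containing (α,β).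
-- The classes of col form the partition S (every class nonempty by col-surj).
record CoherentConfiguration (n r : ℕ) : Set where
  field
    col       : Fin n → Fin n → Fin r
    col-surj  : ∀ (s : Fin r) → ∃[ α ] ∃[ β ] (col α β ≡ s)
    -- 1_Ω is a union of basic relations: a relation meeting the diagonal lies in it
    diag      : ∀ α β γ → col α α ≡ col β γ → β ≡ γ
    star      : Fin r → Fin r
    col-star  : ∀ α β → col β α ≡ star (col α β)
  inter : Fin n → Fin n → Fin r → Fin r → ℕ
  inter α β s t = count (λ γ → does (col α γ ≟ s) ∧ does (col γ β ≟ t))
  field
    -- σ_s σ_t = Σ c_st^u σ_u : the count depends only on the relation containing (α,β)
    const     : ∀ α β α' β' → col α β ≡ col α' β' →
                ∀ s t → inter α β s t ≡ inter α' β' s t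

module _ {n r : ℕ} (X : CoherentConfiguration n r) where
  open CoherentConfiguration X

  -- α and β lie in the same fiber (the fiber of α is {β | (β,β) ∈ 1_Δ with α ∈ Δ})
  SameFiber : Fin n → Fin n → Set
  SameFiber α β = col α α ≡ col β β

  valencyAt : Fin n → Fin n → ℕ
  valencyAt α β = count (λ γ → does (col α γ ≟ col α β))

  InProd : Fin r → Fin r → Fin r → Set
  InProd s t u = ∃[ α ] ∃[ β ] ∃[ γ ] (col α β ≡ u × col α γ ≡ s × col γ β ≡ t)

  Regular : Fin r → Set
  Regular s = ∀ u → (∃[ v ] (InProd s (star s) v × InProd v s u)) ⇔ (u ≡ s)

  InN : Fin r → Set
  InN s = (∃[ α ] ∃[ β ] (col α β ≡ s × SameFiber α β)) ⊎ (¬ Regular s)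

  NRel : Fin n → Fin n → Set
  NRel α β = InN (col α β)

-- C_p ≀ C_p on Z_p × Z_p: the basis relation containing ((x1,y1),(x2,y2)) is
-- encoded by inj₁ a (y1 = y2, a = x2 - x1 mod p) or inj₂ b (y1 ≠ y2, b = y2 - y1 mod p).
diffMod : (p : ℕ) → Fin p → Fin p → ℕ
diffMod p a b = if toℕ a ≤ᵇ toℕ b then toℕ b ∸ toℕ a else (p + toℕ b) ∸ toℕ a

wrRel : (p : ℕ) → Fin p × Fin p → Fin p × Fin p → ℕ ⊎ ℕ
wrRel p (x1 , y1) (x2 , y2) with y1 ≟ y2
... | yes _ = inj₁ (diffMod p x1 x2)
... | no  _ = inj₂ (diffMod p y1 y2)

-- (Ω_i, S_i) ≃ C_p ≀ C_p where Ω_i is the fiber of δ: a bijection f from the fiber onto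
-- Z_p × Z_p mapping each basis relation of S_i onto a basis relation of C_p ≀ C_p
-- (equivalently: pairs lie in the same relation iff their images do).
FiberIsoWr : ∀ {n r} → CoherentConfiguration n r → (p : ℕ) → Fin n → Set
FiberIsoWr {n} X p δ =
  Σ (Fin n → Fin p × Fin p) λ f →
      (∀ α β → SameFiber X δ α → SameFiber X δ β → f α ≡ f β → α ≡ β)
    × (∀ z → ∃[ α ] (SameFiber X δ α × f α ≡ z))
    × (∀ α β α' β' → SameFiber X δ α → SameFiber X δ β → SameFiber X δ α' → SameFiber X δ β' →
         (col α β ≡ col α' β') ⇔ (wrRel p (f α) (f β) ≡ wrRel p (f α') (f β')))
  where open CoherentConfiguration X

{-# OPTIONS --safe #-}
module Submission where

-- For s ∈ S_ij with i ≠ j, regularity of s is equivalent to rectangularity: a s b, c s b and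
-- c s d imply a s d. Since n_s = p is also the size of a block of C_p ≀ C_p (a class
-- {y = const}), s is rectangular exactly when every neighbourhood a s is a whole block of Ω_j;
-- otherwise the p points of a s lie in p different blocks, because two of them in one block at
-- distance d ≢ 0 could, by constancy of the intersection numbers, be translated by d inside every
-- neighbourhood, and as p is prime the translates fill a block. Rectangularity thus depends only
-- on the pair of fibres, which gives transitivity whenever two of three points share a fibre.
-- For three distinct fibres and non-rectangular s ∈ S_ij, t ∈ S_jk, fix β ∈ Ω_j and a block B of
-- Ω_j avoiding β: each of the p s-predecessors of β has one s-neighbour in B, these are pairwise
-- distinct, and if the relation of (α, γ) were rectangular, the t-predecessor of γ in B would be
-- yet another one, giving p + 1 points in a block of size p.

open import Defs
open import Data.Empty using (⊥; ⊥-elim)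
open import Data.Bool using (true; false; T)
open import Data.Fin using (Fin; toℕ; inject≤; combine; remQuot; punchOut) renaming (zero to fz; suc to fs)
open import Data.Fin.Properties
  using (_≟_; suc-injective; inject≤-injective; injective⇒≤; combine-remQuot; any?; punchOut-injective;
         toℕ<n; toℕ-injective)
open import Data.Nat
  using (ℕ; zero; suc; _+_; _*_; _∸_; _≤_; _<_; z≤n; s≤s; _≤ᵇ_; NonZero; >-nonZero; nonTrivial⇒n>1)
open import Data.Nat.DivMod
  using (_%_; _/_; m≡m%n+[m/n]*n; [m+n]%n≡m%n; m<n⇒m%n≡m; %-remove-+ʳ; %-distribˡ-+; m%n%n≡m%n)
open import Data.Nat.Divisibility using (_∣_; divides; >⇒∤)
open import Data.Nat.Primality using (Prime; euclidsLemma; prime⇒nonZero; prime⇒nonTrivial)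
open import Data.Nat.Properties
  using (≤ᵇ⇒≤; <⇒≤; ≤-trans; ≤-reflexive; m≤m+n; m<m*n; m+[n∸m]≡n; m+n∸m≡n; [m+n]∸[m+o]≡n∸o;
         *-distribʳ-∸; *-distribʳ-+; +-comm; +-assoc; +-identityʳ; <-cmp; <-irrefl; n≮n; m<n⇒0<n∸m;
         m∸n≤m; ≤-<-trans)
open import Data.Product using (_×_; _,_; proj₁; proj₂; ∃; ∃-syntax; uncurry)
open import Data.Sum using (_⊎_; inj₁; inj₂)
open import Data.Sum.Properties using (inj₁-injective; inj₂-injective)
open import Function.Bundles using (_⇔_; mk⇔; Equivalence)
open import Function.Definitions using (Injective)
open import Level using (0ℓ)
open import Relation.Binary.Definitions using (tri<; tri≈; tri>)
open import Relation.Binary.PropositionalEquality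
  using (_≡_; _≢_; refl; sym; trans; cong; cong₂; subst; module ≡-Reasoning)
open import Relation.Binary.Structures using (IsEquivalence)
open import Relation.Nullary using (¬_; does; yes; no)
open import Relation.Nullary.Decidable using (_×-dec_; decidable-stable)
open import Relation.Unary using (Pred; Decidable; _⊆_)

countᵈ : ∀ {n} {P : Pred (Fin n) 0ℓ} → Decidable P → ℕ
countᵈ P? = count (λ x → does (P? x))

record Distinct {n : ℕ} (P : Pred (Fin n) 0ℓ) (k : ℕ) : Set where
  field
    member           : Fin k → Fin n
    member-injective : Injective _≡_ _≡_ member
    member-satisfies : ∀ i → P (member i)

rank : ∀ {n} {P : Pred (Fin n) 0ℓ} (P? : Decidable P) (x : Fin n) → P x → Fin (countᵈ P?)
rank P? fz Px with P? fz
... | yes _ = fz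
... | no ¬Px0 with () ← ¬Px0 Px
rank P? (fs x) Px with P? fz
... | yes _ = fs (rank (λ γ → P? (fs γ)) x Px)
... | no _  = rank (λ γ → P? (fs γ)) x Px

rank-injective : ∀ {n} {P : Pred (Fin n) 0ℓ} (P? : Decidable P) {x y : Fin n} (Px : P x) (Py : P y) →
                 rank P? x Px ≡ rank P? y Py → x ≡ y
rank-injective P? {fz}   {fz}   _  _  _ = refl
rank-injective P? {fz}   {fs y} Px Py e with P? fz
... | yes _ with () ← e
... | no ¬Px0 with () ← ¬Px0 Px
rank-injective P? {fs x} {fz}   Px Py e with P? fz
... | yes _ with () ← e
... | no ¬Px0 with () ← ¬Px0 Py
rank-injective P? {fs x} {fs y} Px Py e with P? fz
... | yes _ = cong fs (rank-injective (λ γ → P? (fs γ)) Px Py (suc-injective e))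
... | no _  = cong fs (rank-injective (λ γ → P? (fs γ)) Px Py e)

select : ∀ {n} {P : Pred (Fin n) 0ℓ} (P? : Decidable P) → Fin (countᵈ P?) → Fin n
select {suc n} P? i with P? fz
select {suc n} P? fz     | yes _ = fz
select {suc n} P? (fs i) | yes _ = fs (select (λ γ → P? (fs γ)) i)
select {suc n} P? i      | no _  = fs (select (λ γ → P? (fs γ)) i)

select-satisfies : ∀ {n} {P : Pred (Fin n) 0ℓ} (P? : Decidable P) (i : Fin (countᵈ P?)) → P (select P? i)
select-satisfies {suc n} P? i with P? fz
select-satisfies {suc n} P? fz     | yes P0 = P0
select-satisfies {suc n} P? (fs i) | yes _  = select-satisfies (λ γ → P? (fs γ)) i
select-satisfies {suc n} P? i      | no _   = select-satisfies (λ γ → P? (fs γ)) i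

select-injective : ∀ {n} {P : Pred (Fin n) 0ℓ} (P? : Decidable P) → Injective _≡_ _≡_ (select P?)
select-injective {suc n} P? {i} {j} e with P? fz
select-injective {suc n} P? {fz}   {fz}   e | yes _ = refl
select-injective {suc n} P? {fs i} {fs j} e | yes _ =
  cong fs (select-injective (λ γ → P? (fs γ)) (suc-injective e))
select-injective {suc n} P? {i}    {j}    e | no _  =
  select-injective (λ γ → P? (fs γ)) (suc-injective e)

module _ {n : ℕ} {P : Pred (Fin n) 0ℓ} (P? : Decidable P) where

  Distinct⇒≤countᵈ : ∀ {k} → Distinct P k → k ≤ countᵈ P?
  Distinct⇒≤countᵈ D =
    injective⇒≤ (λ e → member-injective (rank-injective P? (member-satisfies _) (member-satisfies _) e))
    where open Distinct D

  ≤countᵈ⇒Distinct : ∀ {k} → k ≤ countᵈ P? → Distinct P k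
  ≤countᵈ⇒Distinct k≤ = record
    { member           = λ i → select P? (inject≤ i k≤)
    ; member-injective = λ e → inject≤-injective k≤ k≤ _ _ (select-injective P? e)
    ; member-satisfies = λ i → select-satisfies P? (inject≤ i k≤)
    }

module _ {n : ℕ} {P : Pred (Fin n) 0ℓ} where

  Distinct-bound : (P? : Decidable P) → ∀ {k m} → countᵈ P? ≡ m → Distinct P k → k ≤ m
  Distinct-bound P? refl = Distinct⇒≤countᵈ P?

  Distinct-mono : ∀ {Q : Pred (Fin n) 0ℓ} {k} → P ⊆ Q → Distinct P k → Distinct Q k
  Distinct-mono P⊆Q D = record { Distinct D ; member-satisfies = λ i → P⊆Q (Distinct.member-satisfies D i) }

  Distinct-≤ : ∀ {k m} → k ≤ m → Distinct P m → Distinct P k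
  Distinct-≤ k≤m D = record
    { member           = λ i → member (inject≤ i k≤m)
    ; member-injective = λ e → inject≤-injective k≤m k≤m _ _ (member-injective e)
    ; member-satisfies = λ i → member-satisfies (inject≤ i k≤m)
    }
    where open Distinct D

  Distinct-cons : ∀ {k x} → P x → (D : Distinct P k) → (∀ i → Distinct.member D i ≢ x) →
                  Distinct P (suc k)
  Distinct-cons {x = x} Px D fresh = record
    { member           = member′
    ; member-injective = λ {i} {j} → injective i j
    ; member-satisfies = λ { fz → Px ; (fs i) → member-satisfies i }
    }
    where
    open Distinct D
    member′ : Fin (suc _) → Fin n
    member′ fz     = x
    member′ (fs i) = member i
    injective : ∀ i j → member′ i ≡ member′ j → i ≡ j
    injective fz     fz     _ = refl
    injective fz     (fs j) e = ⊥-elim (fresh j (sym e))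
    injective (fs i) fz     e = ⊥-elim (fresh i e)
    injective (fs i) (fs j) e = cong fs (member-injective e)

  Distinct-[] : Distinct P 0
  Distinct-[] = record { member = λ () ; member-injective = λ {} ; member-satisfies = λ () }

Distinct-⋃ : ∀ {n m k} {D : Fin m → Pred (Fin n) 0ℓ} → (∀ {x x′ z} → D x z → D x′ z → x ≡ x′) →
             ((x : Fin m) → Distinct (D x) k) → Distinct (λ z → ∃ λ x → D x z) (m * k)
Distinct-⋃ {n} {m} {k} {D} disjoint F = record
  { member           = λ i → member′ (remQuot {m} k i)
  ; member-injective = λ {i} {j} e →
      trans (sym (combine-remQuot {m} k i))
            (trans (cong (uncurry combine) (member′-injective e)) (combine-remQuot {m} k j))
  ; member-satisfies = λ i → proj₁ (remQuot {m} k i) , satisfies (remQuot {m} k i)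
  }
  where
  open Distinct
  member′ : Fin m × Fin k → Fin n
  member′ (x , j) = member (F x) j
  satisfies : ∀ xj → D (proj₁ xj) (member′ xj)
  satisfies (x , j) = member-satisfies (F x) j
  member′-injective : ∀ {xj yj} → member′ xj ≡ member′ yj → xj ≡ yj
  member′-injective {x , i} {y , j} e with disjoint (satisfies (x , i)) (subst (D y) (sym e) (satisfies (y , j)))
  ... | refl = cong (x ,_) (member-injective (F x) e)

Fin-injective⇒surjective : ∀ {k} (f : Fin k → Fin k) → Injective _≡_ _≡_ f → ∀ y → ∃ λ x → f x ≡ y
Fin-injective⇒surjective f f-inj y with any? (λ x → f x ≟ y)
... | yes hit = hit
Fin-injective⇒surjective {suc k} f f-inj y | no miss =
  ⊥-elim (<-irrefl refl (injective⇒≤ {f = avoid} (λ e → f-inj (punchOut-injective {i = y} _ _ e))))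
  where
  avoid : Fin (suc k) → Fin k
  avoid x = punchOut {i = y} (λ e → miss (x , sym e))

Fin-other : ∀ {k} → 1 < k → (y : Fin k) → ∃[ y′ ] y′ ≢ y
Fin-other (s≤s (s≤s _)) fz     = fs fz , λ ()
Fin-other (s≤s (s≤s _)) (fs _) = fz , λ ()

module _ {p : ℕ} .{{_ : NonZero p}} where

  diffMod-spec : (a b : Fin p) → (toℕ a + diffMod p a b) % p ≡ toℕ b
  diffMod-spec a b with toℕ a ≤ᵇ toℕ b in a≤ᵇb
  ... | true = begin
    (toℕ a + (toℕ b ∸ toℕ a)) % p ≡⟨ cong (_% p) (m+[n∸m]≡n (≤ᵇ⇒≤ (toℕ a) (toℕ b) (subst T (sym a≤ᵇb) _))) ⟩
    toℕ b % p                     ≡⟨ m<n⇒m%n≡m (toℕ<n b) ⟩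
    toℕ b                         ∎
    where open ≡-Reasoning
  ... | false = begin
    (toℕ a + (p + toℕ b ∸ toℕ a)) % p ≡⟨ cong (_% p) (m+[n∸m]≡n (≤-trans (<⇒≤ (toℕ<n a)) (m≤m+n p (toℕ b)))) ⟩
    (p + toℕ b) % p                   ≡⟨ cong (_% p) (+-comm p (toℕ b)) ⟩
    (toℕ b + p) % p                   ≡⟨ [m+n]%n≡m%n (toℕ b) p ⟩
    toℕ b % p                         ≡⟨ m<n⇒m%n≡m (toℕ<n b) ⟩
    toℕ b                             ∎
    where open ≡-Reasoning

  diffMod-injective : (a : Fin p) {b c : Fin p} → diffMod p a b ≡ diffMod p a c → b ≡ c
  diffMod-injective a {b} {c} e =
    toℕ-injective (trans (sym (diffMod-spec a b)) (trans (cong (λ d → (toℕ a + d) % p) e) (diffMod-spec a c)))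

  ∣diffMod⇒≡ : (a b : Fin p) → p ∣ diffMod p a b → a ≡ b
  ∣diffMod⇒≡ a b p∣d = toℕ-injective (begin
    toℕ a                      ≡⟨ m<n⇒m%n≡m (toℕ<n a) ⟨
    toℕ a % p                  ≡⟨ %-remove-+ʳ (toℕ a) p∣d ⟨
    (toℕ a + diffMod p a b) % p ≡⟨ diffMod-spec a b ⟩
    toℕ b                      ∎)
    where open ≡-Reasoning

  [m+k]%p≡[m%p+k]%p : ∀ m k → (m + k) % p ≡ (m % p + k) % p
  [m+k]%p≡[m%p+k]%p m k = begin
    (m + k) % p               ≡⟨ %-distribˡ-+ m k p ⟩
    (m % p + k % p) % p       ≡⟨ cong (λ x → (x + k % p) % p) (m%n%n≡m%n m p) ⟨
    (m % p % p + k % p) % p   ≡⟨ %-distribˡ-+ (m % p) k p ⟨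
    (m % p + k) % p           ∎
    where open ≡-Reasoning

  [m+k]%p≡m%p⇒p∣k : ∀ m k → (m + k) % p ≡ m % p → p ∣ k
  [m+k]%p≡m%p⇒p∣k m k e = divides ((m + k) / p ∸ m / p) (begin
    k                                                   ≡⟨ m+n∸m≡n m k ⟨
    m + k ∸ m                                           ≡⟨ cong₂ _∸_ (m≡m%n+[m/n]*n (m + k) p) (m≡m%n+[m/n]*n m p) ⟩
    ((m + k) % p + (m + k) / p * p) ∸ (m % p + m / p * p) ≡⟨ cong (λ x → (x + (m + k) / p * p) ∸ (m % p + m / p * p)) e ⟩
    (m % p + (m + k) / p * p) ∸ (m % p + m / p * p)     ≡⟨ [m+n]∸[m+o]≡n∸o (m % p) _ _ ⟩
    (m + k) / p * p ∸ m / p * p                         ≡⟨ *-distribʳ-∸ p ((m + k) / p) (m / p) ⟨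
    ((m + k) / p ∸ m / p) * p                           ∎)
    where open ≡-Reasoning

module _ {p : ℕ} (prime : Prime p) where

  private
    instance
      p≢0 : NonZero p
      p≢0 = prime⇒nonZero prime

    x+id+[j∸i]d≡x+jd : ∀ x d {i j} → i ≤ j → x + i * d + (j ∸ i) * d ≡ x + j * d
    x+id+[j∸i]d≡x+jd x d {i} {j} i≤j = begin
      x + i * d + (j ∸ i) * d   ≡⟨ +-assoc x (i * d) ((j ∸ i) * d) ⟩
      x + (i * d + (j ∸ i) * d) ≡⟨ cong (x +_) (*-distribʳ-+ d i (j ∸ i)) ⟨
      x + (i + (j ∸ i)) * d     ≡⟨ cong (λ k → x + k * d) (m+[n∸m]≡n i≤j) ⟩
      x + j * d                 ∎
      where open ≡-Reasoning

    multiples-distinct : ∀ x d {i j} → ¬ p ∣ d → i < j → j < p →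
                         ¬ (x + i * d) % p ≡ (x + j * d) % p
    multiples-distinct x d {i} {j} p∤d i<j j<p e
      with euclidsLemma (j ∸ i) d prime
             ([m+k]%p≡m%p⇒p∣k (x + i * d) ((j ∸ i) * d)
               (trans (cong (_% p) (x+id+[j∸i]d≡x+jd x d (<⇒≤ i<j))) (sym e)))
    ... | inj₁ p∣j∸i = >⇒∤ {{>-nonZero (m<n⇒0<n∸m i<j)}} (≤-<-trans (m∸n≤m j i) j<p) p∣j∸i
    ... | inj₂ p∣d   = p∤d p∣d

  multiples-injective : ∀ x d {i j} → ¬ p ∣ d → i < p → j < p →
                        (x + i * d) % p ≡ (x + j * d) % p → i ≡ j
  multiples-injective x d p∤d i<p j<p e with <-cmp _ _
  ... | tri< i<j _ _ = ⊥-elim (multiples-distinct x d p∤d i<j j<p e)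
  ... | tri≈ _ i≡j _ = i≡j
  ... | tri> _ _ j<i = ⊥-elim (multiples-distinct x d p∤d j<i i<p (sym e))

module CoherentConfigurationProperties {n r : ℕ} (X : CoherentConfiguration n r) where

  open CoherentConfiguration X

  star-involutive : ∀ s → star (star s) ≡ s
  star-involutive s with col-surj s
  ... | α , β , refl = trans (cong star (sym (col-star α β))) (sym (col-star β α))

  col-converse : ∀ {a b s} → col a b ≡ s → col b a ≡ star s
  col-converse {a} {b} e = trans (col-star a b) (cong star e)

  col-converse⁻ : ∀ {a b s} → col a b ≡ star s → col b a ≡ s
  col-converse⁻ {s = s} e = trans (col-converse e) (star-involutive s)

  col-flip : ∀ {a b a′ b′} → col a b ≡ col a′ b′ → col b a ≡ col b′ a′
  col-flip {a′ = a′} {b′} e = trans (col-converse e) (sym (col-star a′ b′))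

  Out : Fin n → Fin r → Pred (Fin n) 0ℓ
  Out a s γ = col a γ ≡ s

  Out? : ∀ a s → Decidable (Out a s)
  Out? a s γ = col a γ ≟ s

  Path : Fin n → Fin n → Fin r → Fin r → Pred (Fin n) 0ℓ
  Path a b s t γ = col a γ ≡ s × col γ b ≡ t

  Path? : ∀ a b s t → Decidable (Path a b s t)
  Path? a b s t γ = (col a γ ≟ s) ×-dec (col γ b ≟ t)

  transfer-paths : ∀ {a b a′ b′ s t k} → col a b ≡ col a′ b′ →
                   Distinct (Path a b s t) k → Distinct (Path a′ b′ s t) k
  transfer-paths {a} {b} {a′} {b′} {s} {t} {k} e D =
    ≤countᵈ⇒Distinct (Path? a′ b′ s t)
      (subst (k ≤_) (const a b a′ b′ e s t) (Distinct⇒≤countᵈ (Path? a b s t) D))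

  transfer : ∀ {a b a′ b′ s t c} → col a b ≡ col a′ b′ → Path a b s t c → ∃ (Path a′ b′ s t)
  transfer e path = member fz , member-satisfies fz
    where open Distinct (transfer-paths e (Distinct-cons path Distinct-[] λ ()))

  transfer₂ : ∀ {a b a′ b′ s t c d} → col a b ≡ col a′ b′ → c ≢ d → Path a b s t c → Path a b s t d →
              Distinct (Path a′ b′ s t) 2
  transfer₂ e c≢d path₁ path₂ =
    transfer-paths e (Distinct-cons path₁ (Distinct-cons path₂ Distinct-[] λ ()) λ { fz e → c≢d (sym e) })

  sameFiber-source : ∀ {a b a′ b′} → col a b ≡ col a′ b′ → SameFiber X a a′
  sameFiber-source {a} {b} e with c , e₁ , _ ← transfer {c = a} e (refl , refl)
    with refl ← diag a _ c (sym e₁) = sym e₁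

  sameFiber-target : ∀ {a b a′ b′} → col a b ≡ col a′ b′ → SameFiber X b b′
  sameFiber-target {a} {b} {b′ = b′} e with c , _ , e₂ ← transfer {c = b} e (refl , refl)
    with refl ← diag b c b′ (sym e₂) = sym e₂

  ¬sameFiber-transport : ∀ {a b a′ b′} → col a b ≡ col a′ b′ → ¬ SameFiber X a′ b′ → ¬ SameFiber X a b
  ¬sameFiber-transport e ¬a′b′ ab = ¬a′b′ (trans (sym (sameFiber-source e)) (trans ab (sameFiber-target e)))

  sameFiber⇒col-realised : ∀ {a a′} b → SameFiber X a a′ → ∃[ b′ ] col a′ b′ ≡ col a b
  sameFiber⇒col-realised b aa′ with b′ , e , _ ← transfer {c = b} aa′ (refl , refl) = b′ , e

  Rectangular : Fin r → Set
  Rectangular s = ∀ {a b c d} → col a b ≡ s → col c b ≡ s → col c d ≡ s → col a d ≡ s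

  Rectangular-star : ∀ {s} → Rectangular s → Rectangular (star s)
  Rectangular-star R e₁ e₂ e₃ = col-converse (R (col-converse⁻ e₃) (col-converse⁻ e₂) (col-converse⁻ e₁))

  Rectangular-converse : ∀ {a b} → Rectangular (col b a) → Rectangular (col a b)
  Rectangular-converse {a} {b} R = subst Rectangular (sym (col-star b a)) (Rectangular-star R)

  Regular⇒Rectangular : ∀ {s} → Regular X s → Rectangular s
  Regular⇒Rectangular reg {a} {b} {c} {d} e₁ e₂ e₃ =
    Equivalence.to (reg (col a d))
      (col a c , (a , c , b , refl , e₁ , col-converse e₂) , (a , d , c , refl , refl , e₃))

  Rectangular⇒Regular : ∀ {s} → Rectangular s → Regular X s
  Rectangular⇒Regular {s} R u = mk⇔ to from
    where
    to : ∃[ v ] (InProd X s (star s) v × InProd X v s u) → u ≡ s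
    to (v , (a , b , c , e₁ , e₂ , e₃) , (a′ , b′ , c′ , f₁ , f₂ , f₃))
      with d , g₁ , g₂ ← transfer (trans e₁ (sym f₂)) (e₂ , e₃)
      = trans (sym f₁) (R g₁ (col-converse⁻ g₂) f₃)
    from : u ≡ s → ∃[ v ] (InProd X s (star s) v × InProd X v s u)
    from refl with α , β , e ← col-surj s =
      col α α , (α , α , β , refl , e , col-converse e) , (α , β , α , e , refl , e)

module _ (p : ℕ) {x₁ y₁ x₂ y₂ : Fin p} where

  wrRel-inBlock : y₁ ≡ y₂ → wrRel p (x₁ , y₁) (x₂ , y₂) ≡ inj₁ (diffMod p x₁ x₂)
  wrRel-inBlock y₁≡y₂ with y₁ ≟ y₂
  ... | yes _    = refl
  ... | no y₁≢y₂ = ⊥-elim (y₁≢y₂ y₁≡y₂)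

  wrRel-acrossBlocks : y₁ ≢ y₂ → wrRel p (x₁ , y₁) (x₂ , y₂) ≡ inj₂ (diffMod p y₁ y₂)
  wrRel-acrossBlocks y₁≢y₂ with y₁ ≟ y₂
  ... | yes y₁≡y₂ = ⊥-elim (y₁≢y₂ y₁≡y₂)
  ... | no _      = refl

module WreathCoordinates {n r : ℕ} (X : CoherentConfiguration n r) {p : ℕ} .{{_ : NonZero p}}
                         (b : Fin n) (iso : FiberIsoWr X p b) where

  open CoherentConfiguration X

  InFiber : Pred (Fin n) 0ℓ
  InFiber = SameFiber X b

  coords : Fin n → Fin p × Fin p
  coords = proj₁ iso

  -- The blocks {block = y} are the copies of C_p, inside which wrRel records differences of pos.
  pos block : Fin n → Fin p
  pos u   = proj₁ (coords u)
  block u = proj₂ (coords u)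

  private
    coords-surjective : ∀ z → ∃[ u ] InFiber u × coords u ≡ z
    coords-surjective = proj₁ (proj₂ (proj₂ iso))

    module _ {u v u′ v′} (u∈ : InFiber u) (v∈ : InFiber v) (u′∈ : InFiber u′) (v′∈ : InFiber v′) where
      col≡⇔wrRel≡ : (col u v ≡ col u′ v′) ⇔ (wrRel p (coords u) (coords v) ≡ wrRel p (coords u′) (coords v′))
      col≡⇔wrRel≡ = proj₂ (proj₂ (proj₂ iso)) u v u′ v′ u∈ v∈ u′∈ v′∈

      col≡⇒wrRel≡ : col u v ≡ col u′ v′ → wrRel p (coords u) (coords v) ≡ wrRel p (coords u′) (coords v′)
      col≡⇒wrRel≡ = Equivalence.to col≡⇔wrRel≡

      wrRel≡⇒col≡ : wrRel p (coords u) (coords v) ≡ wrRel p (coords u′) (coords v′) → col u v ≡ col u′ v′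
      wrRel≡⇒col≡ = Equivalence.from col≡⇔wrRel≡

    inj₁≢inj₂ : ∀ {x y : ℕ} → _≡_ {A = ℕ ⊎ ℕ} (inj₁ x) (inj₂ y) → ⊥
    inj₁≢inj₂ ()

  coords-injective : ∀ {u v} → InFiber u → InFiber v → pos u ≡ pos v → block u ≡ block v → u ≡ v
  coords-injective u∈ v∈ pos≡ block≡ = proj₁ (proj₂ iso) _ _ u∈ v∈ (cong₂ _,_ pos≡ block≡)

  point : Fin p → Fin p → Fin n
  point x y = proj₁ (coords-surjective (x , y))

  point-inFiber : ∀ x y → InFiber (point x y)
  point-inFiber x y = proj₁ (proj₂ (coords-surjective (x , y)))

  point-pos : ∀ x y → pos (point x y) ≡ x
  point-pos x y = cong proj₁ (proj₂ (proj₂ (coords-surjective (x , y))))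

  point-block : ∀ x y → block (point x y) ≡ y
  point-block x y = cong proj₂ (proj₂ (proj₂ (coords-surjective (x , y))))

  module _ {u v u′ v′} (u∈ : InFiber u) (v∈ : InFiber v) (u′∈ : InFiber u′) (v′∈ : InFiber v′)
           (e : col u v ≡ col u′ v′) where

    inBlock-col : block u ≡ block v →
                  block u′ ≡ block v′ × diffMod p (pos u) (pos v) ≡ diffMod p (pos u′) (pos v′)
    inBlock-col uv with block u′ ≟ block v′
    ... | yes u′v′ = u′v′ , inj₁-injective (begin
      inj₁ (diffMod p (pos u) (pos v))   ≡⟨ wrRel-inBlock p uv ⟨
      wrRel p (coords u) (coords v)     ≡⟨ col≡⇒wrRel≡ u∈ v∈ u′∈ v′∈ e ⟩
      wrRel p (coords u′) (coords v′)   ≡⟨ wrRel-inBlock p u′v′ ⟩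
      inj₁ (diffMod p (pos u′) (pos v′)) ∎)
      where open ≡-Reasoning
    ... | no ¬u′v′ = ⊥-elim (inj₁≢inj₂ (trans (sym (wrRel-inBlock p uv))
                     (trans (col≡⇒wrRel≡ u∈ v∈ u′∈ v′∈ e) (wrRel-acrossBlocks p ¬u′v′))))

    acrossBlocks-col : block u ≡ block u′ → block u ≢ block v → block v ≡ block v′
    acrossBlocks-col uu′ ¬uv with block u′ ≟ block v′
    ... | yes u′v′ = ⊥-elim (inj₁≢inj₂ (trans (sym (wrRel-inBlock p u′v′))
                     (trans (sym (col≡⇒wrRel≡ u∈ v∈ u′∈ v′∈ e)) (wrRel-acrossBlocks p ¬uv))))
    ... | no ¬u′v′ = diffMod-injective (block u) (begin
      diffMod p (block u) (block v)   ≡⟨ inj₂-injective (begin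
        inj₂ (diffMod p (block u) (block v))   ≡⟨ wrRel-acrossBlocks p ¬uv ⟨
        wrRel p (coords u) (coords v)         ≡⟨ col≡⇒wrRel≡ u∈ v∈ u′∈ v′∈ e ⟩
        wrRel p (coords u′) (coords v′)       ≡⟨ wrRel-acrossBlocks p ¬u′v′ ⟩
        inj₂ (diffMod p (block u′) (block v′)) ∎) ⟩
      diffMod p (block u′) (block v′) ≡⟨ cong (λ y → diffMod p y (block v′)) uu′ ⟨
      diffMod p (block u) (block v′)  ∎)
      where open ≡-Reasoning

  acrossBlocks-col-const : ∀ {u v v′} → InFiber u → InFiber v → InFiber v′ →
                           block u ≢ block v → block v ≡ block v′ → col u v ≡ col u v′
  acrossBlocks-col-const {u} {v} {v′} u∈ v∈ v′∈ ¬uv vv′ = wrRel≡⇒col≡ u∈ v∈ u∈ v′∈ (begin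
    wrRel p (coords u) (coords v)            ≡⟨ wrRel-acrossBlocks p ¬uv ⟩
    inj₂ (diffMod p (block u) (block v))     ≡⟨ cong (λ y → inj₂ (diffMod p (block u) y)) vv′ ⟩
    inj₂ (diffMod p (block u) (block v′))    ≡⟨ wrRel-acrossBlocks p (λ uv′ → ¬uv (trans uv′ (sym vv′))) ⟨
    wrRel p (coords u) (coords v′)           ∎)
    where open ≡-Reasoning

  InBlock : Fin p → Pred (Fin n) 0ℓ
  InBlock y v = InFiber v × block v ≡ y

  block-members : ∀ y → Distinct (InBlock y) p
  block-members y = record
    { member           = λ x → point x y
    ; member-injective = λ {x} {x′} e → trans (sym (point-pos x y)) (trans (cong pos e) (point-pos x′ y))
    ; member-satisfies = λ x → point-inFiber x y , point-block x y
    }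

  block-bound : ∀ y {k} → Distinct (InBlock y) k → k ≤ p
  block-bound y D = injective⇒≤ {f = λ i → pos (member i)} λ {i} {j} e →
    member-injective (coords-injective (proj₁ (member-satisfies i)) (proj₁ (member-satisfies j)) e
                                       (trans (proj₂ (member-satisfies i)) (sym (proj₂ (member-satisfies j)))))
    where open Distinct D

module WreathFibers {p : ℕ} (prime : Prime p) {n r : ℕ} (X : CoherentConfiguration n r)
                    (iso : ∀ δ → FiberIsoWr X p δ)
                    (valency : ∀ α β → ¬ SameFiber X α β → valencyAt X α β ≡ p) where

  open CoherentConfiguration X
  open CoherentConfigurationProperties X
  open Distinct

  private instance
    p≢0 : NonZero p
    p≢0 = prime⇒nonZero prime

  open module Coordinates (b : Fin n) = WreathCoordinates X b (iso b)

  inFiber-target : ∀ b {a u a′ v} → InFiber b u → col a′ v ≡ col a u → InFiber b v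
  inFiber-target b u∈ e = trans u∈ (sym (sameFiber-target e))

  out-bound : ∀ {a u s k} → col a u ≡ s → ¬ SameFiber X a u → Distinct (Out a s) k → k ≤ p
  out-bound {a} {u} refl ¬au = Distinct-bound (Out? a (col a u)) (valency a u ¬au)

  out-members : ∀ {a u} → ¬ SameFiber X a u → Distinct (Out a (col a u)) p
  out-members {a} {u} ¬au = ≤countᵈ⇒Distinct (Out? a (col a u)) (≤-reflexive (sym (valency a u ¬au)))

  rectangular⇒out⊆block : ∀ b {a u} → InFiber b u → ¬ SameFiber X a u → Rectangular (col a u) →
                          ∀ {v} → col a v ≡ col a u → block b u ≡ block b v
  rectangular⇒out⊆block b {a} {u} u∈ ¬au R {v} av with block b u ≟ block b v
  ... | yes uv = uv
  -- otherwise u and the whole block of v would be p + 1 points w with col a w ≡ col a u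
  ... | no ¬uv = ⊥-elim (n≮n p (out-bound refl ¬au
                   (Distinct-cons refl (Distinct-mono block⊆out (block-members b (block b v))) fresh)))
    where
    block⊆out : ∀ {w} → InBlock b (block b v) w → col a w ≡ col a u
    block⊆out (w∈ , wv)
      with c , cu , cw ← transfer (acrossBlocks-col-const b u∈ (inFiber-target b u∈ av) w∈ ¬uv (sym wv))
                                  (col-converse refl , av)
      = R refl (col-converse⁻ cu) cw
    fresh : ∀ x → point b x (block b v) ≢ u
    fresh x x≡u = ¬uv (trans (cong (block b) (sym x≡u)) (point-block b x _))

  out⊆block⇒block⊆out : ∀ b {a u} → InFiber b u → ¬ SameFiber X a u →
                        (∀ {v} → col a v ≡ col a u → block b u ≡ block b v) →
                        ∀ {w} → InFiber b w → block b u ≡ block b w → col a w ≡ col a u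
  out⊆block⇒block⊆out b {a} {u} u∈ ¬au out⊆block {w} w∈ uw with col a w ≟ col a u
  ... | yes aw = aw
  -- otherwise w and the p points v with col a v ≡ col a u would be p + 1 points of one block
  ... | no ¬aw = ⊥-elim (n≮n p (block-bound b (block b w)
                   (Distinct-cons (w∈ , refl) (Distinct-mono out⊆block′ (out-members ¬au)) fresh)))
    where
    out⊆block′ : ∀ {v} → col a v ≡ col a u → InBlock b (block b w) v
    out⊆block′ av = inFiber-target b u∈ av , trans (sym (out⊆block av)) uw
    fresh : ∀ i → member (out-members ¬au) i ≢ w
    fresh i i≡w = ¬aw (subst (λ z → col a z ≡ col a u) i≡w (member-satisfies (out-members ¬au) i))

  out⊆block⇒rectangular : ∀ b {a u} → InFiber b u → ¬ SameFiber X a u →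
                          (∀ {a′ v v′} → col a′ v ≡ col a u → col a′ v′ ≡ col a u → block b v ≡ block b v′) →
                          Rectangular (col a u)
  out⊆block⇒rectangular b u∈ ¬au out⊆block e₁ e₂ e₃ =
    trans (out⊆block⇒block⊆out b (inFiber-target b u∈ e₁) (¬sameFiber-transport e₁ ¬au)
             (λ e → out⊆block e₁ (trans e e₁)) (inFiber-target b u∈ e₃) (out⊆block e₂ e₃))
          e₁

  rectangular⇒col-determines-block : ∀ b {a u v v′} → InFiber b u → ¬ SameFiber X a u → Rectangular (col a u) →
                                     InFiber b v → InFiber b v′ → col a v ≡ col a v′ → block b v ≡ block b v′
  rectangular⇒col-determines-block b {a} {u} {v} {v′} u∈ ¬au R v∈ v′∈ e with block b u ≟ block b v
  ... | yes uv = trans (sym uv) (out⊆block (trans (sym e) (out⊆block⇒block⊆out b u∈ ¬au out⊆block v∈ uv)))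
    where out⊆block = rectangular⇒out⊆block b u∈ ¬au R
  ... | no ¬uv with δ , aδ , δv′ ← transfer {c = u} e (refl , refl)
    = acrossBlocks-col b u∈ v∈ (inFiber-target b u∈ aδ) v′∈ (sym δv′) (rectangular⇒out⊆block b u∈ ¬au R aδ) ¬uv

  rectangular-sourceFiber : ∀ {α α′ β} → SameFiber X α α′ → ¬ SameFiber X α β →
                            Rectangular (col α β) → Rectangular (col α′ β)
  rectangular-sourceFiber {α} {α′} {β} αα′ ¬αβ R =
    out⊆block⇒rectangular β refl (λ α′β → ¬αβ (trans αα′ α′β)) aligned
    where
    aligned : ∀ {a v v′} → col a v ≡ col α′ β → col a v′ ≡ col α′ β → block β v ≡ block β v′
    aligned {a} av av′ with β₁ , aβ₁ ← sameFiber⇒col-realised β (trans αα′ (sym (sameFiber-source av)))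
      = rectangular⇒col-determines-block β (inFiber-target β refl aβ₁) (¬sameFiber-transport aβ₁ ¬αβ)
          (subst Rectangular (sym aβ₁) R) (inFiber-target β refl av) (inFiber-target β refl av′)
          (trans av (sym av′))

  rectangular-targetFiber : ∀ {α β β′} → SameFiber X β β′ → ¬ SameFiber X α β →
                            Rectangular (col α β) → Rectangular (col α β′)
  rectangular-targetFiber ββ′ ¬αβ R =
    Rectangular-converse (rectangular-sourceFiber ββ′ (λ βα → ¬αβ (sym βα)) (Rectangular-converse R))

  module _ (b : Fin n) {a u v} (u∈ : InFiber b u) (¬au : ¬ SameFiber X a u)
           (av : col a v ≡ col a u) (uv : block b u ≡ block b v) (u≢v : u ≢ v) where

    private
      d : ℕ
      d = diffMod p (pos b u) (pos b v)

      v∈ : InFiber b v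
      v∈ = inFiber-target b u∈ av

      p∤d : ¬ p ∣ d
      p∤d p∣d = u≢v (coords-injective b u∈ v∈ (∣diffMod⇒≡ _ _ p∣d) uv)

      -- Translation by −d within a block preserves every set {z | col a′ z ≡ col a u}; since p is
      -- prime and p ∤ d, iterating it p times produces p distinct points of one block.
      shift-back : ∀ {a′ z} → col a′ z ≡ col a u →
                   ∃[ δ ] col a′ δ ≡ col a u × block b δ ≡ block b z × (toℕ (pos b δ) + d) % p ≡ toℕ (pos b z)
      shift-back {a′} {z} a′z with δ , a′δ , δz ← transfer {c = u} (trans av (sym a′z)) (refl , refl)
        with δz-block , δz-diff ← inBlock-col b u∈ v∈ (inFiber-target b u∈ a′δ) (inFiber-target b u∈ a′z)
                                                (sym δz) uv
        = δ , a′δ , δz-block ,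
          trans (cong (λ k → (toℕ (pos b δ) + k) % p) δz-diff) (diffMod-spec (pos b δ) (pos b z))

      Orbit : Fin n → Fin n → ℕ → Fin n → Set
      Orbit a′ w k z = (col a′ z ≡ col a u × block b w ≡ block b z) × (toℕ (pos b z) + k * d) % p ≡ toℕ (pos b w)

      orbit : ∀ {a′ w} → col a′ w ≡ col a u → ∀ k → ∃ (Orbit a′ w k)
      orbit {w = w} a′w zero = w , (a′w , refl) , trans (cong (_% p) (+-identityʳ _)) (m<n⇒m%n≡m (toℕ<n (pos b w)))
      orbit {w = w} a′w (suc k) with z , (a′z , wz) , zk ← orbit a′w k with δ , a′δ , δz , δd ← shift-back a′z
        = δ , (a′δ , trans wz (sym δz)) , (begin
          (toℕ (pos b δ) + (d + k * d)) % p ≡⟨ cong (_% p) (+-assoc (toℕ (pos b δ)) d (k * d)) ⟨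
          (toℕ (pos b δ) + d + k * d) % p   ≡⟨ [m+k]%p≡[m%p+k]%p (toℕ (pos b δ) + d) (k * d) ⟩
          ((toℕ (pos b δ) + d) % p + k * d) % p ≡⟨ cong (λ x → (x + k * d) % p) δd ⟩
          (toℕ (pos b z) + k * d) % p       ≡⟨ zk ⟩
          toℕ (pos b w)                     ∎)
        where open ≡-Reasoning

      orbit-members : ∀ {a′ w} → col a′ w ≡ col a u →
                      Distinct (λ z → col a′ z ≡ col a u × block b w ≡ block b z) p
      orbit-members {a′} {w} a′w = record
        { member           = λ k → z (toℕ k)
        ; member-injective = λ {i} {j} zi≡zj → toℕ-injective
            (multiples-injective prime (toℕ (pos b (z (toℕ j)))) d p∤d (toℕ<n i) (toℕ<n j)
               (trans (cong (λ y → (toℕ (pos b y) + toℕ i * d) % p) (sym zi≡zj))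
                      (trans (residue (toℕ i)) (sym (residue (toℕ j))))))
        ; member-satisfies = λ k → proj₁ (proj₂ (orbit a′w (toℕ k)))
        }
        where
        z : ℕ → Fin n
        z k = proj₁ (orbit a′w k)
        residue : ∀ k → (toℕ (pos b (z k)) + k * d) % p ≡ toℕ (pos b w)
        residue k = proj₂ (proj₂ (orbit a′w k))

    inBlock-pair⇒rectangular : Rectangular (col a u)
    inBlock-pair⇒rectangular = out⊆block⇒rectangular b u∈ ¬au aligned
      where
      aligned : ∀ {a′ w w′} → col a′ w ≡ col a u → col a′ w′ ≡ col a u → block b w ≡ block b w′
      aligned {a′} {w} {w′} a′w a′w′ with block b w ≟ block b w′
      ... | yes ww′ = ww′
      ... | no ¬ww′ = ⊥-elim (n≮n p (out-bound a′w (¬sameFiber-transport a′w ¬au)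
                        (Distinct-cons a′w′ (Distinct-mono proj₁ (orbit-members a′w)) fresh)))
        where
        fresh : ∀ k → member (orbit-members a′w) k ≢ w′
        fresh k k≡w′ = ¬ww′ (trans (proj₂ (member-satisfies (orbit-members a′w) k)) (cong (block b) k≡w′))

  ¬rectangular⇒out-block-injective : ∀ b {a u} → InFiber b u → ¬ SameFiber X a u → ¬ Rectangular (col a u) →
                                     ∀ {w w′} → col a w ≡ col a u → col a w′ ≡ col a u →
                                     block b w ≡ block b w′ → w ≡ w′
  ¬rectangular⇒out-block-injective b u∈ ¬au ¬R {w} {w′} aw aw′ ww′ with w ≟ w′
  ... | yes w≡w′ = w≡w′
  ... | no w≢w′  = ⊥-elim (¬R (subst Rectangular aw
        (inBlock-pair⇒rectangular b (inFiber-target b u∈ aw) (¬sameFiber-transport aw ¬au)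
                                  (trans aw′ (sym aw)) ww′ w≢w′)))

  ¬rectangular⇒in-block-injective : ∀ b {a u} → ¬ SameFiber X a u → ¬ Rectangular (col a u) →
                                    ∀ {z w w′} → InFiber b w → col w z ≡ col a u → col w′ z ≡ col a u →
                                    block b w ≡ block b w′ → w ≡ w′
  ¬rectangular⇒in-block-injective b ¬au ¬R w∈ wz w′z =
    ¬rectangular⇒out-block-injective b w∈ (λ zw → ¬sameFiber-transport wz ¬au (sym zw))
      (λ R → ¬R (subst Rectangular wz (Rectangular-converse R))) refl (col-flip (trans w′z (sym wz)))

  ¬rectangular⇒out-meets-blocks : ∀ b {a u} → InFiber b u → ¬ SameFiber X a u → ¬ Rectangular (col a u) →
                                  ∀ y → ∃[ z ] col a z ≡ col a u × block b z ≡ y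
  ¬rectangular⇒out-meets-blocks b u∈ ¬au ¬R y = member D (proj₁ hit) , member-satisfies D (proj₁ hit) , proj₂ hit
    where
    D = out-members ¬au
    hit = Fin-injective⇒surjective (λ i → block b (member D i))
            (λ e → member-injective D (¬rectangular⇒out-block-injective b u∈ ¬au ¬R
                                          (member-satisfies D _) (member-satisfies D _) e)) y

  -- The points of one block of the fibre of a have pairwise disjoint (col a u)-neighbourhoods,
  -- so the hypothesis would place 2p points in {z | col c z ≡ s}.
  ¬rectangular⇒no-double-paths : ∀ {a u} → ¬ SameFiber X a u → ¬ Rectangular (col a u) →
                                 ∀ {c e s} → col c e ≡ s → ¬ SameFiber X c e → ∀ y →
                                 ¬ (∀ x → Distinct (λ z → col c z ≡ s × col (point a x y) z ≡ col a u) 2)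
  ¬rectangular⇒no-double-paths {a} {u} ¬au ¬R {c} {s = s} ce ¬ce y paths =
    n≮n p (out-bound ce ¬ce (Distinct-≤ (m<m*n p 2 (s≤s (s≤s z≤n)))
                               (Distinct-mono (λ (_ , cz , _) → cz) (Distinct-⋃ disjoint paths))))
    where
    disjoint : ∀ {x x′ z} → col c z ≡ s × col (point a x y) z ≡ col a u →
               col c z ≡ s × col (point a x′ y) z ≡ col a u → x ≡ x′
    disjoint {x} {x′} (_ , xz) (_ , x′z) =
      trans (sym (point-pos a x y))
        (trans (cong (pos a) (¬rectangular⇒in-block-injective a ¬au ¬R (point-inFiber a x y) xz x′z
                                (trans (point-block a x y) (sym (point-block a x′ y)))))
               (point-pos a x′ y))

  module _ {α β γ} (¬αβ : ¬ SameFiber X α β) (¬βγ : ¬ SameFiber X β γ) (¬αγ : ¬ SameFiber X α γ)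
           (¬Rαβ : ¬ Rectangular (col α β)) (¬Rβγ : ¬ Rectangular (col β γ)) where

    private
      source∈ : ∀ {m} → col m β ≡ col α β → InFiber α m
      source∈ mβ = sym (sameFiber-source mβ)

      ¬sourceβ : ∀ {m} → col m β ≡ col α β → ¬ SameFiber X m β
      ¬sourceβ mβ = ¬sameFiber-transport mβ ¬αβ

      -- Both are instances of ¬rectangular⇒no-double-paths: the two paths through β and through w
      -- are transferred to every point of a block.
      common-out-neighbour : ∀ {m l w} → col m β ≡ col α β → col l β ≡ col α β → m ≢ l →
                             col m w ≡ col α β → col l w ≡ col α β → w ≡ β
      common-out-neighbour {m} {l} {w} mβ lβ m≢l mw lw with w ≟ β
      ... | yes w≡β = w≡β
      ... | no w≢β  = ⊥-elim (¬rectangular⇒no-double-paths ¬αβ ¬Rαβ mβ (¬sourceβ mβ) (block α l) paths)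
        where
        ¬ml : block α m ≢ block α l
        ¬ml ml = m≢l (¬rectangular⇒in-block-injective α ¬αβ ¬Rαβ (source∈ mβ) mβ lβ ml)
        paths : ∀ x → Distinct (λ z → col m z ≡ col α β × col (point α x (block α l)) z ≡ col α β) 2
        paths x = Distinct-mono (λ (mz , zx) → mz , col-converse⁻ zx)
          (transfer₂ (acrossBlocks-col-const α (source∈ mβ) (source∈ lβ) (point-inFiber α x _) ¬ml
                                             (sym (point-block α x _)))
                     (λ β≡w → w≢β (sym β≡w)) (mβ , col-converse lβ) (mw , col-converse lw))

      path-through-β : Rectangular (col α γ) → ∀ {m w} → col m β ≡ col α β →
                       col m w ≡ col α β → col w γ ≡ col β γ → w ≡ β
      path-through-β Rαγ {m} {w} mβ mw wγ with w ≟ β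
      ... | yes w≡β = w≡β
      ... | no w≢β  = ⊥-elim (¬rectangular⇒no-double-paths ¬αβ ¬Rαβ (col-star β γ) (λ γβ → ¬βγ (sym γβ))
                                (block α m) paths)
        where
        ¬γm : ¬ SameFiber X γ m
        ¬γm γm = ¬αγ (trans (source∈ mβ) (sym γm))
        Rγm : Rectangular (col γ m)
        Rγm = Rectangular-converse (rectangular-sourceFiber (source∈ mβ) ¬αγ Rαγ)
        block⊆in : ∀ x → col m γ ≡ col (point α x (block α m)) γ
        block⊆in x = col-flip (sym (out⊆block⇒block⊆out α (source∈ mβ) ¬γm
                                      (rectangular⇒out⊆block α (source∈ mβ) ¬γm Rγm)
                                      (point-inFiber α x _) (sym (point-block α x _))))
        paths : ∀ x → Distinct (λ z → col γ z ≡ star (col β γ) × col (point α x (block α m)) z ≡ col α β) 2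
        paths x = Distinct-mono (λ (xz , zγ) → col-converse zγ , xz)
          (transfer₂ (block⊆in x) (λ β≡w → w≢β (sym β≡w)) (mβ , refl) (mw , wγ))

      sources : Distinct (λ m → col m β ≡ col α β) p
      sources = Distinct-mono col-flip (out-members (λ βα → ¬αβ (sym βα)))

      source : Fin p → Fin n
      source = member sources

      source-β : ∀ i → col (source i) β ≡ col α β
      source-β = member-satisfies sources

      module _ {y₁ : Fin p} (y₁≢ : y₁ ≢ block β β) where

        ≢β : ∀ {q} → block β q ≡ y₁ → q ≢ β
        ≢β qy₁ q≡β = y₁≢ (trans (sym qy₁) (cong (block β) q≡β))

        hit : ∀ i → ∃[ q ] col (source i) q ≡ col (source i) β × block β q ≡ y₁
        hit i = ¬rectangular⇒out-meets-blocks β refl (¬sourceβ (source-β i))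
                  (λ R → ¬Rαβ (subst Rectangular (source-β i) R)) y₁

        q : Fin p → Fin n
        q i = proj₁ (hit i)

        source-q : ∀ i → col (source i) (q i) ≡ col α β
        source-q i = trans (proj₁ (proj₂ (hit i))) (source-β i)

        q-y₁ : ∀ i → block β (q i) ≡ y₁
        q-y₁ i = proj₂ (proj₂ (hit i))

        targets : Distinct (InBlock β y₁) p
        targets = record
          { member           = q
          ; member-injective = injective
          ; member-satisfies = λ i → inFiber-target β refl (source-q i) , q-y₁ i
          }
          where
          injective : ∀ {i j} → q i ≡ q j → i ≡ j
          injective {i} {j} qi≡qj = decidable-stable (i ≟ j) λ i≢j → ≢β (q-y₁ i)
            (common-out-neighbour (source-β i) (source-β j) (λ e → i≢j (member-injective sources e))
               (source-q i) (subst (λ z → col (source j) z ≡ col α β) (sym qi≡qj) (source-q j)))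

    ¬rectangular-composite : ¬ Rectangular (col α γ)
    ¬rectangular-composite Rαγ = n≮n p (block-bound β y₁ (Distinct-cons (qγ∈ , qγy₁) (targets y₁≢) fresh))
      where
      other : ∃[ y ] y ≢ block β β
      other = Fin-other (nonTrivial⇒n>1 p {{prime⇒nonTrivial prime}}) (block β β)

      y₁ : Fin p
      y₁ = proj₁ other

      y₁≢ : y₁ ≢ block β β
      y₁≢ = proj₂ other

      qγ-hit : ∃[ z ] col γ z ≡ col γ β × block β z ≡ y₁
      qγ-hit = ¬rectangular⇒out-meets-blocks β refl (λ γβ → ¬βγ (sym γβ)) (λ R → ¬Rβγ (Rectangular-converse R)) y₁

      qγ∈ : InFiber β (proj₁ qγ-hit)
      qγ∈ = inFiber-target β refl (proj₁ (proj₂ qγ-hit))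

      qγy₁ : block β (proj₁ qγ-hit) ≡ y₁
      qγy₁ = proj₂ (proj₂ qγ-hit)

      fresh : ∀ i → q y₁≢ i ≢ proj₁ qγ-hit
      fresh i qi≡qγ = ≢β y₁≢ (q-y₁ y₁≢ i) (path-through-β Rαγ (source-β i) (source-q y₁≢ i)
        (subst (λ z → col z γ ≡ col β γ) (sym qi≡qγ) (col-flip (proj₁ (proj₂ qγ-hit)))))

  infix 4 _∼_
  _∼_ : Fin n → Fin n → Set
  α ∼ β = SameFiber X α β ⊎ ¬ Rectangular (col α β)

  NRel⇒∼ : ∀ {α β} → NRel X α β → α ∼ β
  NRel⇒∼ (inj₁ (α′ , β′ , e , α′β′)) = inj₁ (trans (sym (sameFiber-source e)) (trans α′β′ (sameFiber-target e)))
  NRel⇒∼ (inj₂ ¬regular)             = inj₂ (λ R → ¬regular (Rectangular⇒Regular R))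

  ∼⇒NRel : ∀ {α β} → α ∼ β → NRel X α β
  ∼⇒NRel {α} {β} (inj₁ αβ) = inj₁ (α , β , refl , αβ)
  ∼⇒NRel (inj₂ ¬R)         = inj₂ (λ regular → ¬R (Regular⇒Rectangular regular))

  ∼-refl : ∀ {α} → α ∼ α
  ∼-refl = inj₁ refl

  ∼-sym : ∀ {α β} → α ∼ β → β ∼ α
  ∼-sym (inj₁ αβ) = inj₁ (sym αβ)
  ∼-sym (inj₂ ¬R) = inj₂ (λ R → ¬R (Rectangular-converse R))

  ∼-across⇒¬rectangular : ∀ {α β} → ¬ SameFiber X α β → α ∼ β → ¬ Rectangular (col α β)
  ∼-across⇒¬rectangular ¬αβ (inj₁ αβ) = ⊥-elim (¬αβ αβ)
  ∼-across⇒¬rectangular ¬αβ (inj₂ ¬R) = ¬R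

  ∼-trans : ∀ {α β γ} → α ∼ β → β ∼ γ → α ∼ γ
  ∼-trans {α} {β} {γ} αβ βγ with col α α ≟ col γ γ
  ... | yes α~γ = inj₁ α~γ
  ... | no ¬α~γ = inj₂ ¬rectangular
    where
    ¬rectangular : ¬ Rectangular (col α γ)
    ¬rectangular Rαγ with col α α ≟ col β β | col β β ≟ col γ γ
    ... | yes α~β | _ =
      ∼-across⇒¬rectangular (λ β~γ → ¬α~γ (trans α~β β~γ)) βγ (rectangular-sourceFiber α~β ¬α~γ Rαγ)
    ... | no ¬α~β | yes β~γ =
      ∼-across⇒¬rectangular ¬α~β αβ (rectangular-targetFiber (sym β~γ) ¬α~γ Rαγ)
    ... | no ¬α~β | no ¬β~γ =
      ¬rectangular-composite ¬α~β ¬β~γ ¬α~γ (∼-across⇒¬rectangular ¬α~β αβ) (∼-across⇒¬rectangular ¬β~γ βγ) Rαγ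

lemma3p4 : (p : ℕ) → Prime p → (n r : ℕ) → (X : CoherentConfiguration n r) →
           (∀ δ → FiberIsoWr X p δ) →
           (∀ α β → ¬ SameFiber X α β → valencyAt X α β ≡ p) →
           IsEquivalence (NRel X)
lemma3p4 p prime n r X iso valency = record
  { refl  = ∼⇒NRel ∼-refl
  ; sym   = λ αβ → ∼⇒NRel (∼-sym (NRel⇒∼ αβ))
  ; trans = λ αβ βγ → ∼⇒NRel (∼-trans (NRel⇒∼ αβ) (NRel⇒∼ βγ))
  }
  where open WreathFibers prime X iso valency
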